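{- Let $G$ be a connected bipartite graph with at least $4$ vertices, $G\neq K_{2,2}$. Then $\Delta_3(D(G))=2$, where $\Delta_3(D(G))$ is the greatest common divisor of all $3\times 3$ minors of the distance matrix $D(G)$.
   Context: For a connected graph $G$, the distance matrix $D(G)$ has rows and columns indexed by the vertices, with $uv$-entry equal to the graph distance $d_G(u,v)$. -}

module Defs where

open import Data.Nat using (ℕ; zero; suc; _≤_; _<_; _≥_)
open import Data.Nat.GCD using (gcd)
open import Data.Integer as ℤ using (ℤ; +_; ∣_∣)
open import Data.Fin using (Fin; toℕ) renaming (_<_ to _<ᶠ_)
open import Data.Fin.Patterns using (0F; 1F; 2F; 3F)
open import Data.Bool using (Bool; true; false)
open import Data.List using (List; []; _∷_; concatMap; foldr; allFin)
open import Data.Product using (Σ; _×_; _,_; ∃)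
open import Relation.Binary.PropositionalEquality using (_≡_; _≢_)
open import Relation.Nullary using (¬_; yes; no)
open import Data.Fin using (_<?_)
open import Function.Bundles using (_↔_; Inverse)

record Graph (n : ℕ) : Set where
  field
    adj   : Fin n → Fin n → Bool
    sym   : ∀ u v → adj u v ≡ adj v u
    irref : ∀ u → adj u u ≡ false
open Graph public

data Walk {n : ℕ} (G : Graph n) : Fin n → Fin n → ℕ → Set where
  nil  : ∀ {u} → Walk G u u 0
  cons : ∀ {u w v k} → adj G u w ≡ true → Walk G w v k → Walk G u v (suc k)

Connected : ∀ {n} → Graph n → Set
Connected G = ∀ u v → ∃ λ k → Walk G u v k

Bipartite : ∀ {n} → Graph n → Set
Bipartite {n} G = Σ (Fin n → Bool) λ c → ∀ u v → adj G u v ≡ true → c u ≢ c v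

IsDistanceMatrix : ∀ {n} → Graph n → (Fin n → Fin n → ℕ) → Set
IsDistanceMatrix G D =
  ∀ u v → Walk G u v (D u v) × (∀ k → Walk G u v k → D u v ≤ k)

Isomorphic : ∀ {n m} → Graph n → Graph m → Set
Isomorphic {n} {m} G H =
  Σ (Fin n ↔ Fin m) λ σ → ∀ u v → adj H (Inverse.to σ u) (Inverse.to σ v) ≡ adj G u v

k22adj : Fin 4 → Fin 4 → Bool
k22adj 0F 2F = true
k22adj 0F 3F = true
k22adj 1F 2F = true
k22adj 1F 3F = true
k22adj 2F 0F = true
k22adj 3F 0F = true
k22adj 2F 1F = true
k22adj 3F 1F = true
k22adj _  _  = false

K22 : Graph 4
K22 = record { adj = k22adj ; sym = s ; irref = i }
  where
  s : ∀ u v → k22adj u v ≡ k22adj v u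
  s 0F 0F = _≡_.refl
  s 0F 1F = _≡_.refl
  s 0F 2F = _≡_.refl
  s 0F 3F = _≡_.refl
  s 1F 0F = _≡_.refl
  s 1F 1F = _≡_.refl
  s 1F 2F = _≡_.refl
  s 1F 3F = _≡_.refl
  s 2F 0F = _≡_.refl
  s 2F 1F = _≡_.refl
  s 2F 2F = _≡_.refl
  s 2F 3F = _≡_.refl
  s 3F 0F = _≡_.refl
  s 3F 1F = _≡_.refl
  s 3F 2F = _≡_.refl
  s 3F 3F = _≡_.refl
  i : ∀ u → k22adj u u ≡ false
  i 0F = _≡_.refl
  i 1F = _≡_.refl
  i 2F = _≡_.refl
  i 3F = _≡_.refl

det3 : (a b c d e f g h i : ℤ) → ℤ
det3 a b c d e f g h i =
  a ℤ.* (e ℤ.* i ℤ.- f ℤ.* h)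
  ℤ.- b ℤ.* (d ℤ.* i ℤ.- f ℤ.* g)
  ℤ.+ c ℤ.* (d ℤ.* h ℤ.- e ℤ.* g)

record Triple (n : ℕ) : Set where
  constructor tri
  field t₁ t₂ t₃ : Fin n

increasingTriples : (n : ℕ) → List (Triple n)
increasingTriples n =
  concatMap (λ i → concatMap (λ j → concatMap (λ k → keep i j k) (allFin n)) (allFin n)) (allFin n)
  where
  keep : Fin n → Fin n → Fin n → List (Triple n)
  keep i j k with i <? j | j <? k
  ... | yes _ | yes _ = tri i j k ∷ []
  ... | _     | _     = []

minor3 : ∀ {n} → (Fin n → Fin n → ℤ) → Triple n → Triple n → ℤ
minor3 M (tri r₁ r₂ r₃) (tri c₁ c₂ c₃) =
  det3 (M r₁ c₁) (M r₁ c₂) (M r₁ c₃)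
       (M r₂ c₁) (M r₂ c₂) (M r₂ c₃)
       (M r₃ c₁) (M r₃ c₂) (M r₃ c₃)

minors3 : ∀ {n} → (Fin n → Fin n → ℤ) → List ℤ
minors3 {n} M =
  concatMap (λ r → concatMap (λ c → minor3 M r c ∷ []) (increasingTriples n)) (increasingTriples n)

-- Δ₃(M): the (nonnegative) gcd of all 3×3 minors of M (gcd of empty list = 0).
Δ₃ : ∀ {n} → (Fin n → Fin n → ℤ) → ℕ
Δ₃ M = foldr (λ m acc → gcd ∣ m ∣ acc) 0 (minors3 M)

{-# OPTIONS --safe #-}
-- A proper 2-colouring col gives d(u,v) ≡ col u + col v (mod 2), so of any three rows of D two
-- agree modulo 2 and every 3×3 minor is even. Conversely some 3×3 minor is ±2. If the diameter is
-- at least 3, take the rows x₀x₁x₂ and columns x₁x₂x₃ of a geodesic x₀x₁x₂x₃. Otherwise G is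
-- complete bipartite; as n ≥ 4 and G ≇ K₂,₂, one side contains three vertices a, b, c, and with
-- a vertex v of the other side, rows v a b and columns v a c give the minor.
module Submission where

open import Defs hiding (sym)
open import Data.Fin using (Fin)
open import Data.Nat using (ℕ; _≥_)
open import Data.Integer using (+_)
open import Relation.Binary.PropositionalEquality using (_≡_)
open import Relation.Nullary using (¬_)

open import Function using (_∘_; flip)
open import Data.Sum using (_⊎_; inj₁; inj₂)
open import Data.Product using (Σ; ∃; ∃₂; _×_; _,_; proj₁; proj₂)
open import Data.Bool using (Bool; true; false; not; _xor_)
open import Data.Bool.Properties using (¬-not; not-injective; xor-same; not-distribˡ-xor)
  renaming (_≟_ to _≟ᵇ_)
import Data.Nat as ℕ
open import Data.Nat using (zero; suc; _≤_; z≤n; s≤s)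
open import Data.Nat.Properties
  using (≤-antisym; n≤0⇒n≡0; ≮⇒≥; +-cancelʳ-≤; +-cancelˡ-≤; +-monoʳ-≤; +-monoˡ-≤; _≤?_; module ≤-Reasoning)
open import Data.Nat.Divisibility using (_∣_; ∣-trans; ∣-antisym; _∣0; m∣m*n)
open import Data.Nat.GCD using (gcd; gcd[m,n]∣m; gcd[m,n]∣n; gcd-greatest)
open import Data.Integer using (ℤ; ∣_∣; _+_; _*_; -_; _-_)
open import Data.Integer.Properties using (∣-i∣≡∣i∣; abs-*)
open import Data.Integer.Solver using (module +-*-Solver)
open import Data.Fin using (_<?_) renaming (_<_ to _<ᶠ_)
open import Data.Fin.Patterns using (0F; 1F; 2F; 3F; 4F)
open import Data.Fin.Properties using (<-cmp; any?; all?)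
open import Data.Fin.Permutation using (Permutation′; _⟨$⟩ʳ_; transpose)
import Data.Fin.Permutation as Permutation
open import Data.List using (List; []; _∷_; foldr; concatMap; allFin)
open import Data.List.Relation.Unary.Any using (here; there; satisfied)
open import Data.List.Membership.Propositional using (_∈_; lose)
open import Data.List.Membership.Propositional.Properties using (∈-concatMap⁺; ∈-concatMap⁻; ∈-allFin)
open import Relation.Binary.Construct.Closure.ReflexiveTransitive using (Star; ε; _◅_)
open import Relation.Binary.Definitions using (tri<; tri≈; tri>)
open import Relation.Binary.PropositionalEquality
  using (refl; sym; trans; cong; cong₂; subst; _≢_; module ≡-Reasoning)
open import Relation.Nullary using (yes; no)
open import Relation.Nullary.Decidable using (from-yes)
open import Relation.Nullary.Negation using (contradiction)

Matrix : ℕ → Set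
Matrix n = Fin n → Fin n → ℤ

gcdAbs : List ℤ → ℕ
gcdAbs = foldr (λ m acc → gcd ∣ m ∣ acc) 0

gcdAbs-greatest : ∀ {d} xs → (∀ {m} → m ∈ xs → d ∣ ∣ m ∣) → d ∣ gcdAbs xs
gcdAbs-greatest {d} []   _    = d ∣0
gcdAbs-greatest (x ∷ xs) d∣xs = gcd-greatest (d∣xs (here refl)) (gcdAbs-greatest xs (d∣xs ∘ there))

gcdAbs∣ : ∀ {m xs} → m ∈ xs → gcdAbs xs ∣ ∣ m ∣
gcdAbs∣ {xs = x ∷ xs} (here refl)  = gcd[m,n]∣m ∣ x ∣ (gcdAbs xs)
gcdAbs∣ {xs = x ∷ xs} (there m∈xs) = ∣-trans (gcd[m,n]∣n ∣ x ∣ (gcdAbs xs)) (gcdAbs∣ m∈xs)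

Sorted : ∀ {n} → Triple n → Set
Sorted (tri a b c) = a <ᶠ b × b <ᶠ c

Distinct : ∀ {n} → Triple n → Set
Distinct (tri a b c) = a ≢ b × a ≢ c × b ≢ c

-- Unification names the local filter of `increasingTriples`, so that its tests can be cased on.
increasingTriples-filter : ∀ n → Σ (Fin n → Fin n → Fin n → List (Triple n)) λ keep →
  increasingTriples n ≡ concatMap (λ i → concatMap (λ j → concatMap (keep i j) (allFin n)) (allFin n)) (allFin n)
increasingTriples-filter n = _ , refl

sorted-kept : ∀ {n} {i j k : Fin n} → Sorted (tri i j k) → tri i j k ∈ proj₁ (increasingTriples-filter n) i j k
sorted-kept {i = i} {j} {k} (i<j , j<k) with i <? j | j <? k
... | yes _   | yes _   = here refl
... | no i≮j  | _       = contradiction i<j i≮j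
... | yes _   | no j≮k  = contradiction j<k j≮k

sorted∈increasingTriples : ∀ {n} {R : Triple n} → Sorted R → R ∈ increasingTriples n
sorted∈increasingTriples {R = tri i j k} sorted =
  ∈-concatMap⁺ _ (lose (∈-allFin i) (∈-concatMap⁺ _ (lose (∈-allFin j)
    (∈-concatMap⁺ _ (lose (∈-allFin k) (sorted-kept sorted))))))

∈minors3⁻ : ∀ {n} (M : Matrix n) {m} → m ∈ minors3 M → ∃₂ λ R C → m ≡ minor3 M R C
∈minors3⁻ {n} M m∈
  with R , m∈ᴿ     ← satisfied (∈-concatMap⁻ _ {xs = increasingTriples n} m∈)
  with C , here m≡ ← satisfied (∈-concatMap⁻ _ {xs = increasingTriples n} m∈ᴿ) = R , C , m≡

Δ₃-greatest : ∀ {n d} (M : Matrix n) → (∀ R C → d ∣ ∣ minor3 M R C ∣) → d ∣ Δ₃ M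
Δ₃-greatest M d∣minors = gcdAbs-greatest (minors3 M) λ m∈ →
  let R , C , m≡ = ∈minors3⁻ M m∈ in subst (λ m → _ ∣ ∣ m ∣) (sym m≡) (d∣minors R C)

Δ₃∣sorted-minor3 : ∀ {n} (M : Matrix n) {R C} → Sorted R → Sorted C → Δ₃ M ∣ ∣ minor3 M R C ∣
Δ₃∣sorted-minor3 M sortedR sortedC = gcdAbs∣
  (∈-concatMap⁺ _ (lose (sorted∈increasingTriples sortedR)
    (∈-concatMap⁺ _ (lose (sorted∈increasingTriples sortedC) (here refl)))))

module Det3Identities where
  open +-*-Solver

  det3ᵖ : ∀ {m} (a b c d e f g h i : Polynomial m) → Polynomial m
  det3ᵖ a b c d e f g h i = a :* (e :* i :- f :* h) :- b :* (d :* i :- f :* g) :+ c :* (d :* h :- e :* g)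

  det3-swap₁₂ : ∀ a b c d e f g h i → det3 d e f a b c g h i ≡ - det3 a b c d e f g h i
  det3-swap₁₂ = solve 9 (λ a b c d e f g h i → det3ᵖ d e f a b c g h i := :- det3ᵖ a b c d e f g h i) refl

  det3-swap₂₃ : ∀ a b c d e f g h i → det3 a b c g h i d e f ≡ - det3 a b c d e f g h i
  det3-swap₂₃ = solve 9 (λ a b c d e f g h i → det3ᵖ a b c g h i d e f := :- det3ᵖ a b c d e f g h i) refl

  det3-transpose : ∀ a b c d e f g h i → det3 a d g b e h c f i ≡ det3 a b c d e f g h i
  det3-transpose = solve 9 (λ a b c d e f g h i → det3ᵖ a d g b e h c f i := det3ᵖ a b c d e f g h i) refl

  det3-row₂-multiple : ∀ k a b c p q r g h i →
    det3 a b c (a + k * p) (b + k * q) (c + k * r) g h i ≡ k * det3 a b c p q r g h i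
  det3-row₂-multiple = solve 10 (λ k a b c p q r g h i →
    det3ᵖ a b c (a :+ k :* p) (b :+ k :* q) (c :+ k :* r) g h i := k :* det3ᵖ a b c p q r g h i) refl

open Det3Identities

x≡-y⇒∣x∣≡∣y∣ : ∀ {x y} → x ≡ - y → ∣ x ∣ ≡ ∣ y ∣
x≡-y⇒∣x∣≡∣y∣ {y = y} refl = ∣-i∣≡∣i∣ y

data Swap {n} : Triple n → Triple n → Set where
  swap₁₂ : ∀ {a b c} → Swap (tri a b c) (tri b a c)
  swap₂₃ : ∀ {a b c} → Swap (tri a b c) (tri a c b)

minor3-swap : ∀ {n} (M : Matrix n) {R R′} C → Swap R R′ → ∣ minor3 M R C ∣ ≡ ∣ minor3 M R′ C ∣
minor3-swap M (tri x y z) (swap₁₂ {a} {b} {c}) = sym (x≡-y⇒∣x∣≡∣y∣ (det3-swap₁₂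
  (M a x) (M a y) (M a z) (M b x) (M b y) (M b z) (M c x) (M c y) (M c z)))
minor3-swap M (tri x y z) (swap₂₃ {a} {b} {c}) = sym (x≡-y⇒∣x∣≡∣y∣ (det3-swap₂₃
  (M a x) (M a y) (M a z) (M b x) (M b y) (M b z) (M c x) (M c y) (M c z)))

minor3-permute-rows : ∀ {n} (M : Matrix n) {R R′} C → Star Swap R R′ → ∣ minor3 M R C ∣ ≡ ∣ minor3 M R′ C ∣
minor3-permute-rows M C ε        = refl
minor3-permute-rows M C (s ◅ ss) = trans (minor3-swap M C s) (minor3-permute-rows M C ss)

minor3-transpose : ∀ {n} (M : Matrix n) R C → minor3 (flip M) C R ≡ minor3 M R C
minor3-transpose M (tri a b c) (tri x y z) =
  det3-transpose (M a x) (M a y) (M a z) (M b x) (M b y) (M b z) (M c x) (M c y) (M c z)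

minor3-permute-columns : ∀ {n} (M : Matrix n) R {C C′} → Star Swap C C′ → ∣ minor3 M R C ∣ ≡ ∣ minor3 M R C′ ∣
minor3-permute-columns M R {C} {C′} C↝C′ = begin
  ∣ minor3 M R C ∣          ≡⟨ cong ∣_∣ (minor3-transpose M R C) ⟨
  ∣ minor3 (flip M) C R ∣   ≡⟨ minor3-permute-rows (flip M) R C↝C′ ⟩
  ∣ minor3 (flip M) C′ R ∣  ≡⟨ cong ∣_∣ (minor3-transpose M R C′) ⟩
  ∣ minor3 M R C′ ∣         ∎
  where open ≡-Reasoning

sort-triple : ∀ {n} (R : Triple n) → Distinct R → ∃ λ R′ → Sorted R′ × Star Swap R R′
sort-triple (tri a b c) (a≢b , a≢c , b≢c) with <-cmp a b
... | tri≈ _ a≡b _ = contradiction a≡b a≢b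
... | tri< a<b _ _ with <-cmp b c | <-cmp a c
...   | tri< b<c _ _ | _            = tri a b c , (a<b , b<c) , ε
...   | tri≈ _ b≡c _ | _            = contradiction b≡c b≢c
...   | tri> _ _ c<b | tri< a<c _ _ = tri a c b , (a<c , c<b) , swap₂₃ ◅ ε
...   | tri> _ _ c<b | tri≈ _ a≡c _ = contradiction a≡c a≢c
...   | tri> _ _ c<b | tri> _ _ c<a = tri c a b , (c<a , a<b) , swap₂₃ ◅ swap₁₂ ◅ ε
sort-triple (tri a b c) (a≢b , a≢c , b≢c) | tri> _ _ b<a with <-cmp a c | <-cmp b c
...   | tri< a<c _ _ | _            = tri b a c , (b<a , a<c) , swap₁₂ ◅ ε
...   | tri≈ _ a≡c _ | _            = contradiction a≡c a≢c
...   | tri> _ _ c<a | tri< b<c _ _ = tri b c a , (b<c , c<a) , swap₁₂ ◅ swap₂₃ ◅ ε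
...   | tri> _ _ c<a | tri≈ _ b≡c _ = contradiction b≡c b≢c
...   | tri> _ _ c<a | tri> _ _ c<b = tri c b a , (c<b , b<a) , swap₁₂ ◅ swap₂₃ ◅ swap₁₂ ◅ ε

Δ₃∣minor3 : ∀ {n} (M : Matrix n) {R C} → Distinct R → Distinct C → Δ₃ M ∣ ∣ minor3 M R C ∣
Δ₃∣minor3 M {R} {C} distinctR distinctC
  with R′ , sortedR′ , R↝R′ ← sort-triple R distinctR
     | C′ , sortedC′ , C↝C′ ← sort-triple C distinctC =
  subst (Δ₃ M ∣_) (sym (trans (minor3-permute-rows M C R↝R′) (minor3-permute-columns M R′ C↝C′)))
    (Δ₃∣sorted-minor3 M sortedR′ sortedC′)

k∣∣k*x∣ : ∀ k x → k ∣ ∣ + k * x ∣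
k∣∣k*x∣ k x = subst (k ∣_) (sym (abs-* (+ k) x)) (m∣m*n ∣ x ∣)

minor3-congruent-rows : ∀ {n} k (M : Matrix n) {r₁ r₂ r₃} C →
  (∀ v → ∃ λ q → M r₂ v ≡ M r₁ v + + k * q) → k ∣ ∣ minor3 M (tri r₁ r₂ r₃) C ∣
minor3-congruent-rows k M {r₁} {r₂} {r₃} (tri c₁ c₂ c₃) r₂≡r₁
  with p , e₁ ← r₂≡r₁ c₁ | q , e₂ ← r₂≡r₁ c₂ | r , e₃ ← r₂≡r₁ c₃ rewrite e₁ | e₂ | e₃ =
  subst (λ x → k ∣ ∣ x ∣)
    (sym (det3-row₂-multiple (+ k) (M r₁ c₁) (M r₁ c₂) (M r₁ c₃) p q r (M r₃ c₁) (M r₃ c₂) (M r₃ c₃)))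
    (k∣∣k*x∣ k _)

two-of-three-equal : ∀ (x y z : Bool) → x ≡ y ⊎ x ≡ z ⊎ y ≡ z
two-of-three-equal true  true  _     = inj₁ refl
two-of-three-equal false false _     = inj₁ refl
two-of-three-equal true  false true  = inj₂ (inj₁ refl)
two-of-three-equal false true  false = inj₂ (inj₁ refl)
two-of-three-equal true  false false = inj₂ (inj₂ refl)
two-of-three-equal false true  true  = inj₂ (inj₂ refl)

RowsCongruentWithinColours : ∀ {n} → ℕ → (Fin n → Bool) → Matrix n → Set
RowsCongruentWithinColours k col M = ∀ {u w} → col u ≡ col w → ∀ v → ∃ λ q → M w v ≡ M u v + + k * q

minor3-divisible : ∀ {n} k (col : Fin n → Bool) (M : Matrix n) → RowsCongruentWithinColours k col M →
  ∀ R C → k ∣ ∣ minor3 M R C ∣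
minor3-divisible k col M congruent (tri r₁ r₂ r₃) C with two-of-three-equal (col r₁) (col r₂) (col r₃)
... | inj₁ c₁≡c₂ = minor3-congruent-rows k M C (congruent c₁≡c₂)
... | inj₂ (inj₁ c₁≡c₃) = subst (k ∣_) (sym (minor3-permute-rows M C (swap₂₃ ◅ ε)))
  (minor3-congruent-rows k M C (congruent c₁≡c₃))
... | inj₂ (inj₂ c₂≡c₃) = subst (k ∣_) (sym (minor3-permute-rows M C (swap₁₂ ◅ swap₂₃ ◅ ε)))
  (minor3-congruent-rows k M C (congruent c₂≡c₃))

Monochromatic : ∀ {n} → (Fin n → Bool) → Triple n → Set
Monochromatic col (tri a b c) = col a ≡ col b × col a ≡ col c

ThreeOfAColour : ∀ {n} → (Fin n → Bool) → Set
ThreeOfAColour col = ∃ λ R → Distinct R × Monochromatic col R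

ProperColouring : ∀ {n} → Graph n → (Fin n → Bool) → Set
ProperColouring G col = ∀ u v → adj G u v ≡ true → col u ≢ col v

has-neighbour : ∀ {n} (G : Graph n) → Connected G → ∀ {u v} → u ≢ v → ∃ λ w → adj G u w ≡ true
has-neighbour G connected {u} {v} u≢v with connected u v
... | _ , nil      = contradiction refl u≢v
... | _ , cons e _ = _ , e

≢-≢⇒≡ : ∀ {x y z : Bool} → x ≢ y → y ≢ z → x ≡ z
≢-≢⇒≡ x≢y y≢z = trans (¬-not x≢y) (sym (¬-not (y≢z ∘ sym)))

xor-≢ : ∀ {x y} → x ≢ y → x xor y ≡ true
xor-≢ {x} {y} x≢y = begin
  x xor y       ≡⟨ cong (_xor y) (¬-not x≢y) ⟩
  not y xor y   ≡⟨ not-distribˡ-xor y y ⟨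
  not (y xor y) ≡⟨ cong not (xor-same y) ⟩
  true          ∎
  where open ≡-Reasoning

χ : Bool → ℤ
χ true  = + 1
χ false = + 0

χ-≢ : ∀ {x y} → x ≢ y → χ x + χ y ≡ + 1
χ-≢ {true}  {false} _ = refl
χ-≢ {false} {true}  _ = refl
χ-≢ {true}  {true}  x≢y = contradiction refl x≢y
χ-≢ {false} {false} x≢y = contradiction refl x≢y

module ParityIdentities where
  open +-*-Solver

  nil-parity : ∀ x → + 0 ≡ x + x + + 2 * - x
  nil-parity = solve 1 (λ x → con (+ 0) := x :+ x :+ con (+ 2) :* :- x) refl

  cons-parity : ∀ x y z q → (x + y) + (y + z + + 2 * q) ≡ x + z + + 2 * (q + y)
  cons-parity = solve 4 (λ x y z q →
    (x :+ y) :+ (y :+ z :+ con (+ 2) :* q) := x :+ z :+ con (+ 2) :* (q :+ y)) refl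

  shift-parity : ∀ x z q q′ → x + z + + 2 * q′ ≡ (x + z + + 2 * q) + + 2 * (q′ - q)
  shift-parity = solve 4 (λ x z q q′ →
    x :+ z :+ con (+ 2) :* q′ := (x :+ z :+ con (+ 2) :* q) :+ con (+ 2) :* (q′ :- q)) refl

open ParityIdentities

module Distances {n} (G : Graph n) (D : Fin n → Fin n → ℕ) (isD : IsDistanceMatrix G D) where

  distanceMatrix : Matrix n
  distanceMatrix u v = + D u v

  geodesic : ∀ u v → Walk G u v (D u v)
  geodesic u v = proj₁ (isD u v)

  D-minimal : ∀ {u v k} → Walk G u v k → D u v ≤ k
  D-minimal {u} {v} {k} = proj₂ (isD u v) k

  _++ʷ_ : ∀ {u w v k l} → Walk G u w k → Walk G w v l → Walk G u v (k ℕ.+ l)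
  nil      ++ʷ q = q
  cons e p ++ʷ q = cons e (p ++ʷ q)

  triangle : ∀ u w v → D u v ≤ D u w ℕ.+ D w v
  triangle u w v = D-minimal (geodesic u w ++ʷ geodesic w v)

  D-refl : ∀ u → D u u ≡ 0
  D-refl u = n≤0⇒n≡0 (D-minimal nil)

  D≡0⇒≡ : ∀ {u v} → D u v ≡ 0 → u ≡ v
  D≡0⇒≡ {u} {v} D≡0 with nil ← subst (Walk G u v) D≡0 (geodesic u v) = refl

  D≡suc⇒≢ : ∀ {u v k} → D u v ≡ suc k → u ≢ v
  D≡suc⇒≢ {u} D≡suc refl with () ← trans (sym (D-refl u)) D≡suc

  adjacent⇒≢ : ∀ {u v} → adj G u v ≡ true → u ≢ v
  adjacent⇒≢ {u} e refl with () ← trans (sym e) (irref G u)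

  adjacent⇒D≡1 : ∀ {u v} → adj G u v ≡ true → D u v ≡ 1
  adjacent⇒D≡1 {u} {v} e with D u v in D≡ | D-minimal (cons e nil)
  ... | zero  | _       = contradiction (D≡0⇒≡ D≡) (adjacent⇒≢ e)
  ... | suc _ | s≤s z≤n = refl

  D≡1⇒adjacent : ∀ {u v} → D u v ≡ 1 → adj G u v ≡ true
  D≡1⇒adjacent {u} {v} D≡1 with cons e nil ← subst (Walk G u v) D≡1 (geodesic u v) = e

  geodesic-prefix : ∀ {u w v k l} → Walk G u w k → Walk G w v l → D u v ≡ k ℕ.+ l → D u w ≡ k
  geodesic-prefix {u} {w} {v} {k} {l} p q D≡ = ≤-antisym (D-minimal p) (+-cancelʳ-≤ l k (D u w) (begin
    k ℕ.+ l         ≡⟨ D≡ ⟨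
    D u v           ≤⟨ triangle u w v ⟩
    D u w ℕ.+ D w v ≤⟨ +-monoʳ-≤ (D u w) (D-minimal q) ⟩
    D u w ℕ.+ l     ∎))
    where open ≤-Reasoning

  geodesic-suffix : ∀ {u w v k l} → Walk G u w k → Walk G w v l → D u v ≡ k ℕ.+ l → D w v ≡ l
  geodesic-suffix {u} {w} {v} {k} {l} p q D≡ = ≤-antisym (D-minimal q) (+-cancelˡ-≤ k l (D w v) (begin
    k ℕ.+ l         ≡⟨ D≡ ⟨
    D u v           ≤⟨ triangle u w v ⟩
    D u w ℕ.+ D w v ≤⟨ +-monoˡ-≤ (D w v) (D-minimal p) ⟩
    k ℕ.+ D w v     ∎))
    where open ≤-Reasoning

  -- The minor is det [[1,2,3],[0,1,2],[1,0,1]] = 2.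
  long-geodesic⇒Δ₃∣2 : ∀ {u v k} → Walk G u v k → D u v ≡ k → 3 ≤ k → Δ₃ distanceMatrix ∣ 2
  long-geodesic⇒Δ₃∣2 {x₀} (cons {w = x₁} e₁ (cons {w = x₂} e₂ (cons {w = x₃} e₃ rest))) D≡ (s≤s (s≤s (s≤s _))) =
    subst (Δ₃ distanceMatrix ∣_) minor≡2
      (Δ₃∣minor3 distanceMatrix (D≡suc⇒≢ d₀₁ , D≡suc⇒≢ d₀₂ , D≡suc⇒≢ d₁₂)
                                (D≡suc⇒≢ d₁₂ , D≡suc⇒≢ d₁₃ , D≡suc⇒≢ d₂₃))
    where
    d₀₃ : D x₀ x₃ ≡ 3
    d₀₃ = geodesic-prefix (cons e₁ (cons e₂ (cons e₃ nil))) rest D≡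
    d₀₂ : D x₀ x₂ ≡ 2
    d₀₂ = geodesic-prefix (cons e₁ (cons e₂ nil)) (cons e₃ nil) d₀₃
    d₁₃ : D x₁ x₃ ≡ 2
    d₁₃ = geodesic-suffix (cons e₁ nil) (cons e₂ (cons e₃ nil)) d₀₃
    d₀₁ : D x₀ x₁ ≡ 1
    d₀₁ = adjacent⇒D≡1 e₁
    d₁₂ : D x₁ x₂ ≡ 1
    d₁₂ = adjacent⇒D≡1 e₂
    d₂₁ : D x₂ x₁ ≡ 1
    d₂₁ = adjacent⇒D≡1 (trans (Graph.sym G x₂ x₁) e₂)
    d₂₃ : D x₂ x₃ ≡ 1
    d₂₃ = adjacent⇒D≡1 e₃
    minor≡2 : ∣ minor3 distanceMatrix (tri x₀ x₁ x₂) (tri x₁ x₂ x₃) ∣ ≡ 2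
    minor≡2 rewrite d₀₁ | d₀₂ | d₀₃ | D-refl x₁ | d₁₂ | d₁₃ | d₂₁ | D-refl x₂ | d₂₃ = refl

  module Coloured (col : Fin n → Bool) (proper : ProperColouring G col) where

    walk-parity : ∀ {u v k} → Walk G u v k → ∃ λ q → + k ≡ χ (col u) + χ (col v) + + 2 * q
    walk-parity {u} nil = - χ (col u) , nil-parity (χ (col u))
    walk-parity {u} {v} {suc k} (cons {w = w} e p) with q , k≡ ← walk-parity p = q + χ (col w) , (begin
      + 1 + + k
        ≡⟨ cong₂ _+_ (sym (χ-≢ (proper u w e))) k≡ ⟩
      (χ (col u) + χ (col w)) + (χ (col w) + χ (col v) + + 2 * q)
        ≡⟨ cons-parity (χ (col u)) (χ (col w)) (χ (col v)) q ⟩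
      χ (col u) + χ (col v) + + 2 * (q + χ (col w))
        ∎)
      where open ≡-Reasoning

    rows-congruent-mod-2 : RowsCongruentWithinColours 2 col distanceMatrix
    rows-congruent-mod-2 {u} {w} cu≡cw v
      with q , Duv≡ ← walk-parity (geodesic u v) | q′ , Dwv≡ ← walk-parity (geodesic w v) = q′ - q , (begin
      + D w v                                            ≡⟨ Dwv≡ ⟩
      χ (col w) + χ (col v) + + 2 * q′                   ≡⟨ cong (λ c → χ c + χ (col v) + + 2 * q′) cu≡cw ⟨
      χ (col u) + χ (col v) + + 2 * q′                   ≡⟨ shift-parity (χ (col u)) (χ (col v)) q q′ ⟩
      (χ (col u) + χ (col v) + + 2 * q) + + 2 * (q′ - q) ≡⟨ cong (_+ + 2 * (q′ - q)) Duv≡ ⟨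
      + D u v + + 2 * (q′ - q)                           ∎)
      where open ≡-Reasoning

    2∣Δ₃ : 2 ∣ Δ₃ distanceMatrix
    2∣Δ₃ = Δ₃-greatest distanceMatrix (minor3-divisible 2 col distanceMatrix rows-congruent-mod-2)

    module SmallDiameter (diameter≤2 : ∀ u v → D u v ≤ 2) where

      short-walk-between-colours : ∀ {u v k} → Walk G u v k → k ≤ 2 → col u ≢ col v → k ≡ 1
      short-walk-between-colours nil _ cu≢cv = contradiction refl cu≢cv
      short-walk-between-colours (cons e nil) _ _ = refl
      short-walk-between-colours {u} {v} (cons {w = w} e (cons e′ nil)) _ cu≢cv =
        contradiction (≢-≢⇒≡ (proper u w e) (proper w v e′)) cu≢cv
      short-walk-between-colours (cons _ (cons _ (cons _ _))) (s≤s (s≤s ())) _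

      short-walk-within-colour : ∀ {u v k} → Walk G u v k → k ≤ 2 → col u ≡ col v → u ≢ v → k ≡ 2
      short-walk-within-colour nil _ _ u≢v = contradiction refl u≢v
      short-walk-within-colour {u} {v} (cons e nil) _ cu≡cv _ = contradiction cu≡cv (proper u v e)
      short-walk-within-colour (cons e (cons e′ nil)) _ _ _ = refl
      short-walk-within-colour (cons _ (cons _ (cons _ _))) (s≤s (s≤s ())) _ _

      D-between-colours : ∀ {u v} → col u ≢ col v → D u v ≡ 1
      D-between-colours {u} {v} = short-walk-between-colours (geodesic u v) (diameter≤2 u v)

      D-within-colour : ∀ {u v} → col u ≡ col v → u ≢ v → D u v ≡ 2
      D-within-colour {u} {v} = short-walk-within-colour (geodesic u v) (diameter≤2 u v)

      adj≡xor : ∀ u v → adj G u v ≡ col u xor col v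
      adj≡xor u v with col u ≟ᵇ col v
      ... | no cu≢cv = trans (D≡1⇒adjacent (D-between-colours cu≢cv)) (sym (xor-≢ cu≢cv))
      ... | yes cu≡cv rewrite cu≡cv | xor-same (col v) = ¬-not (λ e → proper u v e cu≡cv)

      -- The minor is det [[0,1,1],[1,0,2],[1,2,2]] = 2.
      claw⇒Δ₃∣2 : ∀ {v a b c} → col v ≢ col a → Monochromatic col (tri a b c) → Distinct (tri a b c) →
        Δ₃ distanceMatrix ∣ 2
      claw⇒Δ₃∣2 {v} {a} {b} {c} cv≢ca (ca≡cb , ca≡cc) (a≢b , a≢c , b≢c) =
        subst (Δ₃ distanceMatrix ∣_) minor≡2
          (Δ₃∣minor3 distanceMatrix (v≢ refl , v≢ ca≡cb , a≢b) (v≢ refl , v≢ ca≡cc , a≢c))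
        where
        v≢ : ∀ {x} → col a ≡ col x → v ≢ x
        v≢ ca≡cx refl = cv≢ca (sym ca≡cx)
        cv≢ : ∀ {x} → col a ≡ col x → col v ≢ col x
        cv≢ ca≡cx cv≡cx = cv≢ca (trans cv≡cx (sym ca≡cx))
        minor≡2 : ∣ minor3 distanceMatrix (tri v a b) (tri v a c) ∣ ≡ 2
        minor≡2 rewrite D-refl v | D-between-colours cv≢ca | D-between-colours (cv≢ ca≡cc)
                      | D-between-colours (cv≢ca ∘ sym) | D-refl a | D-within-colour ca≡cc a≢c
                      | D-between-colours (cv≢ ca≡cb ∘ sym) | D-within-colour (sym ca≡cb) (a≢b ∘ sym)
                      | D-within-colour (trans (sym ca≡cb) ca≡cc) b≢c = refl

      three-of-a-colour⇒Δ₃∣2 : Connected G → ThreeOfAColour col → Δ₃ distanceMatrix ∣ 2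
      three-of-a-colour⇒Δ₃∣2 connected (tri a b c , distinct@(a≢b , _) , monochromatic)
        with v , e ← has-neighbour G connected a≢b =
        claw⇒Δ₃∣2 (proper a v e ∘ sym) monochromatic distinct

K22-colour : Fin 4 → Bool
K22-colour 0F = true
K22-colour 1F = true
K22-colour 2F = false
K22-colour 3F = false

K22-adj≡xor : ∀ u v → adj K22 u v ≡ K22-colour u xor K22-colour v
K22-adj≡xor = from-yes (all? λ u → all? λ v → adj K22 u v ≟ᵇ K22-colour u xor K22-colour v)

≅K22 : (G : Graph 4) (col : Fin 4 → Bool) → (∀ u v → adj G u v ≡ col u xor col v) →
  (σ : Permutation′ 4) → (∀ u → col u ≡ K22-colour (σ ⟨$⟩ʳ u)) → Isomorphic G K22
≅K22 G col adj≡xor σ col≡ = σ , λ u v → begin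
  adj K22 (σ ⟨$⟩ʳ u) (σ ⟨$⟩ʳ v)                   ≡⟨ K22-adj≡xor (σ ⟨$⟩ʳ u) (σ ⟨$⟩ʳ v) ⟩
  K22-colour (σ ⟨$⟩ʳ u) xor K22-colour (σ ⟨$⟩ʳ v) ≡⟨ cong₂ _xor_ (col≡ u) (col≡ v) ⟨
  col u xor col v                                 ≡⟨ adj≡xor u v ⟨
  adj G u v                                       ∎
  where open ≡-Reasoning

pointwise₄ : ∀ {f g : Fin 4 → Bool} → f 0F ≡ g 0F → f 1F ≡ g 1F → f 2F ≡ g 2F → f 3F ≡ g 3F →
  ∀ u → f u ≡ g u
pointwise₄ e₀ _  _  _  0F = e₀
pointwise₄ _  e₁ _  _  1F = e₁
pointwise₄ _  _  e₂ _  2F = e₂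
pointwise₄ _  _  _  e₃ 3F = e₃

monochromatic : ∀ {n} {col : Fin n → Bool} {x} a b c → Distinct (tri a b c) →
  col a ≡ x → col b ≡ x → col c ≡ x → ThreeOfAColour col
monochromatic a b c distinct ca cb cc = tri a b c , distinct , trans ca (sym cb) , trans ca (sym cc)

three-of-a-colour-or-K22-colouring : (col : Fin 4 → Bool) → col 0F ≡ true →
  ThreeOfAColour col ⊎ ∃ λ σ → ∀ u → col u ≡ K22-colour (σ ⟨$⟩ʳ u)
three-of-a-colour-or-K22-colouring col c₀ with col 1F in c₁ | col 2F in c₂ | col 3F in c₃
... | true  | true  | _     = inj₁ (monochromatic 0F 1F 2F ((λ ()) , (λ ()) , (λ ())) c₀ c₁ c₂)
... | true  | false | true  = inj₁ (monochromatic 0F 1F 3F ((λ ()) , (λ ()) , (λ ())) c₀ c₁ c₃)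
... | false | true  | true  = inj₁ (monochromatic 0F 2F 3F ((λ ()) , (λ ()) , (λ ())) c₀ c₂ c₃)
... | false | false | false = inj₁ (monochromatic 1F 2F 3F ((λ ()) , (λ ()) , (λ ())) c₁ c₂ c₃)
... | true  | false | false = inj₂ (Permutation.id , pointwise₄ c₀ c₁ c₂ c₃)
... | false | true  | false = inj₂ (transpose 1F 2F , pointwise₄ c₀ c₁ c₂ c₃)
... | false | false | true  = inj₂ (transpose 1F 3F , pointwise₄ c₀ c₁ c₂ c₃)

three-of-a-colour-among-five : ∀ {m} (col : Fin (5 ℕ.+ m) → Bool) → col 0F ≡ true → ThreeOfAColour col
three-of-a-colour-among-five col c₀ with col 1F in c₁ | col 2F in c₂ | col 3F in c₃ | col 4F in c₄
... | true  | true  | _     | _     = monochromatic 0F 1F 2F ((λ ()) , (λ ()) , (λ ())) c₀ c₁ c₂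
... | true  | false | true  | _     = monochromatic 0F 1F 3F ((λ ()) , (λ ()) , (λ ())) c₀ c₁ c₃
... | false | true  | true  | _     = monochromatic 0F 2F 3F ((λ ()) , (λ ()) , (λ ())) c₀ c₂ c₃
... | false | false | false | _     = monochromatic 1F 2F 3F ((λ ()) , (λ ()) , (λ ())) c₁ c₂ c₃
... | true  | false | false | true  = monochromatic 0F 1F 4F ((λ ()) , (λ ()) , (λ ())) c₀ c₁ c₄
... | true  | false | false | false = monochromatic 2F 3F 4F ((λ ()) , (λ ()) , (λ ())) c₂ c₃ c₄
... | false | true  | false | true  = monochromatic 0F 2F 4F ((λ ()) , (λ ()) , (λ ())) c₀ c₂ c₄
... | false | true  | false | false = monochromatic 1F 3F 4F ((λ ()) , (λ ()) , (λ ())) c₁ c₃ c₄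
... | false | false | true  | true  = monochromatic 0F 3F 4F ((λ ()) , (λ ()) , (λ ())) c₀ c₃ c₄
... | false | false | true  | false = monochromatic 1F 2F 4F ((λ ()) , (λ ()) , (λ ())) c₁ c₂ c₄

three-of-a-colour-unless-K22 : ∀ m (G : Graph (4 ℕ.+ m)) col → col 0F ≡ true →
  (∀ u v → adj G u v ≡ col u xor col v) → ¬ Isomorphic G K22 → ThreeOfAColour col
three-of-a-colour-unless-K22 zero G col c₀ adj≡xor G≇K22 with three-of-a-colour-or-K22-colouring col c₀
... | inj₁ three       = three
... | inj₂ (σ , col≡) = contradiction (≅K22 G col adj≡xor σ col≡) G≇K22
three-of-a-colour-unless-K22 (suc m) _ col c₀ _ _ = three-of-a-colour-among-five col c₀

normalised-colouring : ∀ {n} (G : Graph (suc n)) → Bipartite G →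
  ∃ λ col → ProperColouring G col × col 0F ≡ true
normalised-colouring G (col , proper) with col 0F in c₀
... | true  = col , proper , c₀
... | false = not ∘ col , (λ u v e → proper u v e ∘ not-injective) , cong not c₀

mainTheorem5 : (n : ℕ) → n ≥ 4 → (G : Graph n) → Connected G → Bipartite G
    → ¬ Isomorphic G K22
    → (D : Fin n → Fin n → ℕ) → IsDistanceMatrix G D
    → Δ₃ (λ u v → + (D u v)) ≡ 2
mainTheorem5 (suc (suc (suc (suc m)))) (s≤s (s≤s (s≤s (s≤s _)))) G connected bipartite G≇K22 D isD
  with col , proper , c₀ ← normalised-colouring G bipartite =
  ∣-antisym Δ₃∣2 2∣Δ₃
  where
  open Distances G D isD
  open Coloured col proper

  Δ₃∣2 : Δ₃ distanceMatrix ∣ 2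
  Δ₃∣2 with any? (λ u → any? (λ v → 3 ≤? D u v))
  ... | yes (u , v , 3≤D) = long-geodesic⇒Δ₃∣2 (geodesic u v) refl 3≤D
  ... | no ¬far = three-of-a-colour⇒Δ₃∣2 connected (three-of-a-colour-unless-K22 m G col c₀ adj≡xor G≇K22)
    where open SmallDiameter (λ u v → ≮⇒≥ (¬far ∘ (u ,_) ∘ (v ,_)))
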